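{- Let $G$ be an $(m,n)$-cylindrical grid and let $\Pi$ be a pattern of size $k$ with $V(\Pi)$ contained in a boundary cycle of $G$. If $\Pi$ is cross-free (with respect to the cyclic order of that boundary cycle) and $n\geq k$, then $G$ has a $\Pi$-linkage.
   Context: The $(m,n)$-cylindrical grid is the Cartesian product $C_m\,\square\,P_n$ of a cycle of length $m$ and a path with $n$ vertices; its two cycles of length $m$ passing only through degree-3 vertices are the boundary cycles. A pattern $\Pi$ in a graph is a collection of pairwise disjoint vertex sets of size 1 or 2, $V(\Pi)=\bigcup\Pi$, and its size is $|\Pi|$. A $\Pi$-linkage is a collection of pairwise vertex-disjoint paths, one for each $\{s,t\}\in\Pi$, with ends $s$ and $t$. If $V(\Pi)$ lies in a cyclically ordered set, $\Pi$ is cross-free if there are no distinct $a,b,c,d\in V(\Pi)$ with $\{a,b\},\{c,d\}\in\Pi$ whose cyclic order is $a,c,b,d$ or $a,d,b,c$. -}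

module Defs where

open import Data.Nat using (ℕ; zero; suc; _<_; _≤_)
open import Data.Fin using (Fin; toℕ)
open import Data.Product using (_×_; _,_; Σ; ∃)
open import Data.Sum using (_⊎_)
open import Data.List using (List; []; _∷_; length; concatMap; lookup)
open import Data.List.Relation.Unary.Unique.Propositional using (Unique)
open import Data.List.Membership.Propositional using (_∈_)
open import Relation.Binary.PropositionalEquality using (_≡_; _≢_)
open import Relation.Nullary using (¬_)

-- The (m,n)-cylindrical grid C_m □ P_n.
-- Vertices: (i , j) with i : Fin m (position on the cycle C_m, cyclic
-- order 0,1,…,m-1,0) and j : Fin n (position on the path P_n).

Vertex : ℕ → ℕ → Set
Vertex m n = Fin m × Fin n

CycAdj : (m : ℕ) → Fin m → Fin m → Set
CycAdj m i j =
  (suc (toℕ i) ≡ toℕ j) ⊎ (suc (toℕ j) ≡ toℕ i) ⊎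
  ((toℕ i ≡ 0 × suc (toℕ j) ≡ m) ⊎ (toℕ j ≡ 0 × suc (toℕ i) ≡ m))

PathAdj : (n : ℕ) → Fin n → Fin n → Set
PathAdj n j j' = (suc (toℕ j) ≡ toℕ j') ⊎ (suc (toℕ j') ≡ toℕ j)

Adj : (m n : ℕ) → Vertex m n → Vertex m n → Set
Adj m n (i , j) (i' , j') = (j ≡ j' × CycAdj m i i') ⊎ (i ≡ i' × PathAdj n j j')

-- A boundary cycle is the row  Fin m × {b}  with b the first or last
-- vertex of the path P_n.
IsBoundaryRow : (n : ℕ) → Fin n → Set
IsBoundaryRow n b = (toℕ b ≡ 0) ⊎ (suc (toℕ b) ≡ n)

data Walk (m n : ℕ) : Vertex m n → Vertex m n → List (Vertex m n) → Set where
  trivial : (x : Vertex m n) → Walk m n x x (x ∷ [])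
  step    : {x y t : Vertex m n} {p : List (Vertex m n)} →
            Adj m n x y → Walk m n y t p → Walk m n x t (x ∷ p)

IsPath : (m n : ℕ) → Vertex m n → Vertex m n → List (Vertex m n) → Set
IsPath m n s t p = Walk m n s t p × Unique p

-- Patterns whose vertices lie on the boundary row b.  A block is a
-- vertex set of size 1 ({x}) or 2 ({s,t}, s ≠ t), given by positions
-- on the boundary cycle (i.e. elements of Fin m).

data Block (m : ℕ) : Set where
  single : Fin m → Block m
  pair   : (s t : Fin m) → s ≢ t → Block m

blockVerts : {m : ℕ} → Block m → List (Fin m)
blockVerts (single x) = x ∷ []
blockVerts (pair s t _) = s ∷ t ∷ []

srcB : {m : ℕ} → Block m → Fin m
srcB (single x) = x
srcB (pair s _ _) = s

tgtB : {m : ℕ} → Block m → Fin m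
tgtB (single x) = x
tgtB (pair _ t _) = t

Pattern : ℕ → Set
Pattern m = List (Block m)

IsPattern : {m : ℕ} → Pattern m → Set
IsPattern Π = Unique (concatMap blockVerts Π)

PairIn : {m : ℕ} → Fin m → Fin m → Pattern m → Set
PairIn s t Π = ∃ λ b → b ∈ Π × ((srcB b ≡ s × tgtB b ≡ t) ⊎ (srcB b ≡ t × tgtB b ≡ s)) × s ≢ t

Cyc4 : {m : ℕ} → Fin m → Fin m → Fin m → Fin m → Set
Cyc4 a b c d =
  (toℕ a < toℕ b × toℕ b < toℕ c × toℕ c < toℕ d) ⊎
  (toℕ b < toℕ c × toℕ c < toℕ d × toℕ d < toℕ a) ⊎
  (toℕ c < toℕ d × toℕ d < toℕ a × toℕ a < toℕ b) ⊎
  (toℕ d < toℕ a × toℕ a < toℕ b × toℕ b < toℕ c)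

Distinct4 : {m : ℕ} → Fin m → Fin m → Fin m → Fin m → Set
Distinct4 a b c d =
  a ≢ b × a ≢ c × a ≢ d × b ≢ c × b ≢ d × c ≢ d

CrossFree : {m : ℕ} → Pattern m → Set
CrossFree Π = ∀ a b c d → Distinct4 a b c d → PairIn a b Π → PairIn c d Π →
  ¬ (Cyc4 a c b d ⊎ Cyc4 a d b c)

record Linkage (m n : ℕ) (b : Fin n) (Π : Pattern m) : Set where
  field
    path    : Fin (length Π) → List (Vertex m n)
    isPath  : ∀ i → IsPath m n (srcB (lookup Π i) , b) (tgtB (lookup Π i) , b) (path i)
    disjoint : ∀ i j (v : Vertex m n) → v ∈ path i → v ∈ path j → i ≡ j

-- Sort the two ends of every pair along the boundary cycle, so that each pair
-- spans an interval [s, t] of columns.  The pair is routed along a U: down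
-- column s to depth d, along that row to column t, and back up, where d is the
-- number of pairs whose interval lies inside [s, t] (the pair itself included).
-- Cross-freeness makes the intervals laminar: two of them are either side by
-- side, and then their U's are disjoint, or nested, and then the inner one has
-- strictly smaller depth and its U runs strictly inside the outer U.  As d ≤ k ≤ n,
-- depth n is only reached by a pair enclosing every block; that pair instead
-- goes round the back of the cylinder through row 1.  Singletons stay where
-- they are, and the walks obtained this way are finally shortcut to paths.
module Submission where

open import Defs
open import Function using (_∘_; id)
open import Data.Empty using (⊥; ⊥-elim)
open import Data.Product using (_×_; _,_; proj₁; proj₂; ∃; ∃₂)
open import Data.Product.Properties using (≡-dec)
open import Data.Sum using (_⊎_; inj₁; inj₂)
open import Data.Nat using (ℕ; zero; suc; _≤_; _<_; _≤′_; ≤′-refl; ≤′-step; z≤n; s≤s; s≤s⁻¹; _∸_; _≤?_; _<?_)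
open import Data.Nat.Properties
open import Data.Fin as Fin using (Fin; toℕ)
open import Data.Fin.Properties using (toℕ-injective; toℕ≤pred[n]; opposite-prop)
open import Data.List using (List; []; _∷_; _++_; length; concatMap; lookup; filter)
open import Data.List.Properties using (filter-some; filter-notAll)
open import Data.List.Relation.Unary.Any using (Any; here; there; any?)
open import Data.List.Relation.Unary.All as All using (All; []; _∷_)
open import Data.List.Relation.Unary.All.Properties using (¬Any⇒All¬)
open import Data.List.Relation.Unary.AllPairs using ([]; _∷_)
open import Data.List.Relation.Unary.Unique.Propositional using (Unique)
open import Data.List.Relation.Binary.Subset.Propositional using (_⊆_)
open import Data.List.Relation.Binary.Disjoint.Propositional using (Disjoint)
import Data.List.Relation.Binary.Disjoint.Propositional.Properties as Disjoint
open import Data.List.Membership.Propositional using (_∈_; lose)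
open import Data.List.Membership.Propositional.Properties using (∈-lookup; ∈-++⁺ˡ; ∈-++⁺ʳ)
open import Relation.Nullary using (¬_; Dec; yes; no; contradiction)
open import Relation.Nullary.Decidable using (_×-dec_)
open import Relation.Unary using (Decidable)
open import Relation.Binary.PropositionalEquality using (_≡_; _≢_; refl; sym; trans; cong; cong₂; subst₂)
open import Relation.Binary using (tri<; tri≈; tri>)

private
  variable
    A B : Set
    s t d s′ t′ d′ c e c′ e′ x : ℕ

module _ {P Q : A → Set} (P? : Decidable P) (Q? : Decidable Q) where

  length-filter-≤ : ∀ xs → (∀ {x} → x ∈ xs → P x → Q x) →
                    length (filter P? xs) ≤ length (filter Q? xs)
  length-filter-≤ [] _ = z≤n
  length-filter-≤ (x ∷ xs) P⇒Q with ih ← length-filter-≤ xs (P⇒Q ∘ there) | P? x | Q? x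
  ... | yes _  | yes _   = s≤s ih
  ... | yes px | no ¬qx  = contradiction (P⇒Q (here refl) px) ¬qx
  ... | no _   | yes _   = m≤n⇒m≤1+n ih
  ... | no _   | no _    = ih

  length-filter-< : ∀ xs → (∀ {x} → x ∈ xs → P x → Q x) → Any (λ x → Q x × ¬ P x) xs →
                    length (filter P? xs) < length (filter Q? xs)
  length-filter-< (x ∷ xs) P⇒Q (here (qx , ¬px)) with P? x | Q? x
  ... | yes px | _      = contradiction px ¬px
  ... | no _   | yes _  = s≤s (length-filter-≤ xs (P⇒Q ∘ there))
  ... | no _   | no ¬qx = contradiction qx ¬qx
  length-filter-< (x ∷ xs) P⇒Q (there any) with ih ← length-filter-< xs (P⇒Q ∘ there) any | P? x | Q? x
  ... | yes _  | yes _  = s≤s ih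
  ... | yes px | no ¬qx = contradiction (P⇒Q (here refl) px) ¬qx
  ... | no _   | yes _  = m<n⇒m<1+n ih
  ... | no _   | no _   = ih

Unique-++⁻ʳ : (xs : List A) {ys : List A} → Unique (xs ++ ys) → Unique ys
Unique-++⁻ʳ []       u       = u
Unique-++⁻ʳ (x ∷ xs) (_ ∷ u) = Unique-++⁻ʳ xs u

Unique-++⇒Disjoint : (xs : List A) {ys : List A} → Unique (xs ++ ys) → Disjoint xs ys
Unique-++⇒Disjoint (x ∷ xs) (x∉ ∷ _) (here refl , v∈ys) = All.lookup x∉ (∈-++⁺ʳ xs v∈ys) refl
Unique-++⇒Disjoint (x ∷ xs) (_ ∷ u)  (there v∈xs , v∈ys) = Unique-++⇒Disjoint xs u (v∈xs , v∈ys)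

module _ (f : A → List B) where

  ∈-concatMap-lookup : ∀ xs i {v} → v ∈ f (lookup xs i) → v ∈ concatMap f xs
  ∈-concatMap-lookup (x ∷ xs) Fin.zero    v∈ = ∈-++⁺ˡ v∈
  ∈-concatMap-lookup (x ∷ xs) (Fin.suc i) v∈ = ∈-++⁺ʳ (f x) (∈-concatMap-lookup xs i v∈)

  Unique-concatMap⇒Disjoint : ∀ xs → Unique (concatMap f xs) → ∀ {i j} → i ≢ j →
                              Disjoint (f (lookup xs i)) (f (lookup xs j))
  Unique-concatMap⇒Disjoint (x ∷ xs) u {Fin.zero}  {Fin.zero}  i≢j = contradiction refl i≢j
  Unique-concatMap⇒Disjoint (x ∷ xs) u {Fin.zero}  {Fin.suc j} _ (v∈ , w∈) =
    Unique-++⇒Disjoint (f x) u (v∈ , ∈-concatMap-lookup xs j w∈)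
  Unique-concatMap⇒Disjoint (x ∷ xs) u {Fin.suc i} {Fin.zero}  _ (v∈ , w∈) =
    Unique-++⇒Disjoint (f x) u (w∈ , ∈-concatMap-lookup xs i v∈)
  Unique-concatMap⇒Disjoint (x ∷ xs) u {Fin.suc i} {Fin.suc j} i≢j =
    Unique-concatMap⇒Disjoint xs (Unique-++⁻ʳ (f x) u) (i≢j ∘ cong Fin.suc)

module _ {m n : ℕ} where

  private
    variable
      u v w : Vertex m n
      R S : Vertex m n → Set

    _≟ᵥ_ : (u v : Vertex m n) → Dec (u ≡ v)
    _≟ᵥ_ = ≡-dec Fin._≟_ Fin._≟_

  CycAdj-sym : {i j : Fin m} → CycAdj m i j → CycAdj m j i
  CycAdj-sym (inj₁ e)               = inj₂ (inj₁ e)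
  CycAdj-sym (inj₂ (inj₁ e))        = inj₁ e
  CycAdj-sym (inj₂ (inj₂ (inj₁ e))) = inj₂ (inj₂ (inj₂ e))
  CycAdj-sym (inj₂ (inj₂ (inj₂ e))) = inj₂ (inj₂ (inj₁ e))

  PathAdj-sym : {i j : Fin n} → PathAdj n i j → PathAdj n j i
  PathAdj-sym (inj₁ e) = inj₂ e
  PathAdj-sym (inj₂ e) = inj₁ e

  Adj-sym : Adj m n u v → Adj m n v u
  Adj-sym (inj₁ (e , a)) = inj₁ (sym e , CycAdj-sym a)
  Adj-sym (inj₂ (e , a)) = inj₂ (sym e , PathAdj-sym a)

  walk-suffix : ∀ {p} → Walk m n v w p → Unique p → u ∈ p →
                ∃ λ q → Walk m n u w q × Unique q × q ⊆ p
  walk-suffix (trivial _) up (here refl) = _ , trivial _ , up , id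
  walk-suffix (step a ws) up (here refl) = _ , step a ws , up , id
  walk-suffix (step a ws) (_ ∷ up) (there u∈) with q , wq , uq , q⊆ ← walk-suffix ws up u∈ =
    q , wq , uq , there ∘ q⊆

  walk⇒path : ∀ {r} → Walk m n u w r → ∃ λ p → Walk m n u w p × Unique p × p ⊆ r
  walk⇒path (trivial x) = _ , trivial x , [] ∷ [] , id
  walk⇒path {u} (step a ws) with p , wp , up , p⊆ ← walk⇒path ws | any? (u ≟ᵥ_) p
  ... | yes u∈p = let q , wq , uq , q⊆ = walk-suffix wp up u∈p in q , wq , uq , there ∘ p⊆ ∘ q⊆
  ... | no u∉p  = u ∷ p , step a wp , ¬Any⇒All¬ p u∉p ∷ up ,
                  λ { (here e) → here e ; (there v∈) → there (p⊆ v∈) }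

  record WalkIn (R : Vertex m n → Set) (x y : Vertex m n) : Set where
    constructor walkIn
    field
      vertices : List (Vertex m n)
      walk     : Walk m n x y vertices
      inside   : All R vertices

  open WalkIn public

  [_]ᵂ : R u → WalkIn R u u
  [ r ]ᵂ = walkIn _ (trivial _) (r ∷ [])

  stepᵂ : Adj m n u v → R u → WalkIn R v w → WalkIn R u w
  stepᵂ a r (walkIn _ ws rs) = walkIn _ (step a ws) (r ∷ rs)

  infixr 5 _++ᵂ_

  _++ᵂ_ : WalkIn R u v → WalkIn R v w → WalkIn R u w
  _++ᵂ_ {R = R} {v = v} {w = w} (walkIn _ ws rs) ws′ = go ws rs
    where
    go : ∀ {u p} → Walk m n u v p → All R p → WalkIn R u w
    go (trivial _)  _        = ws′
    go (step a ws)  (r ∷ rs) = stepᵂ a r (go ws rs)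

  reverseᵂ : WalkIn R u v → WalkIn R v u
  reverseᵂ {R = R} {v = v} (walkIn _ ws rs) = go ws rs
    where
    first : ∀ {u p} → Walk m n u v p → All R p → R u
    first (trivial _) (r ∷ _) = r
    first (step _ _)  (r ∷ _) = r

    go : ∀ {u p} → Walk m n u v p → All R p → WalkIn R v u
    go (trivial _)  rs       = walkIn _ (trivial _) rs
    go (step a ws)  (r ∷ rs) = go ws rs ++ᵂ stepᵂ (Adj-sym a) (first ws rs) [ r ]ᵂ

  mapᵂ : (∀ {x} → R x → S x) → WalkIn R u v → WalkIn S u v
  mapᵂ f (walkIn p ws rs) = walkIn p ws (All.map f rs)

  pathIn : WalkIn R u v → ∃ λ p → IsPath m n u v p × All R p
  pathIn (walkIn _ ws rs) with p , wp , up , p⊆ ← walk⇒path ws =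
    p , (wp , up) , All.tabulate (All.lookup rs ∘ p⊆)

-- Saturates at k; only ever applied to arguments c ≤ k.
clamp : (k : ℕ) → ℕ → Fin (suc k)
clamp k       zero    = Fin.zero
clamp zero    (suc c) = Fin.zero
clamp (suc k) (suc c) = Fin.suc (clamp k c)

toℕ-clamp : ∀ {k c} → c ≤ k → toℕ (clamp k c) ≡ c
toℕ-clamp {c = zero}  _         = refl
toℕ-clamp {suc k} {suc c} (s≤s c≤k) = cong suc (toℕ-clamp c≤k)

clamp-toℕ : ∀ k (i : Fin (suc k)) → clamp k (toℕ i) ≡ i
clamp-toℕ k       Fin.zero    = refl
clamp-toℕ (suc k) (Fin.suc i) = cong Fin.suc (clamp-toℕ k i)

record RowOrder (n′ : ℕ) (b : Fin (suc n′)) : Set where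
  field
    row           : ℕ → Fin (suc n′)
    row-0         : row 0 ≡ b
    row-adjacent  : ∀ {e} → e < n′ → PathAdj (suc n′) (row e) (row (suc e))
    row-injective : ∀ {e e′} → e ≤ n′ → e′ ≤ n′ → row e ≡ row e′ → e ≡ e′

rowOrder : ∀ {n′} {b : Fin (suc n′)} → IsBoundaryRow (suc n′) b → RowOrder n′ b
rowOrder {n′} (inj₁ b≡0) = record
  { row           = clamp n′
  ; row-0         = toℕ-injective (sym b≡0)
  ; row-adjacent  = λ e<n′ → inj₁ (trans (cong suc (toℕ-clamp (<⇒≤ e<n′))) (sym (toℕ-clamp e<n′)))
  ; row-injective = λ e≤ e′≤ eq → trans (sym (toℕ-clamp e≤)) (trans (cong toℕ eq) (toℕ-clamp e′≤))
  }
rowOrder {n′} (inj₂ b≡n′) = record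
  { row           = Fin.opposite ∘ clamp n′
  ; row-0         = toℕ-injective (trans (toℕ-opposite-clamp z≤n) (sym (suc-injective b≡n′)))
  ; row-adjacent  = λ {e} e<n′ → inj₂ (opposite-adjacent e e<n′)
  ; row-injective = λ e≤ e′≤ eq →
      ∸-cancelˡ-≡ e≤ e′≤ (trans (sym (toℕ-opposite-clamp e≤)) (trans (cong toℕ eq) (toℕ-opposite-clamp e′≤)))
  }
  where
  toℕ-opposite-clamp : ∀ {e} → e ≤ n′ → toℕ (Fin.opposite (clamp n′ e)) ≡ n′ ∸ e
  toℕ-opposite-clamp {e} e≤ = trans (opposite-prop (clamp n′ e)) (cong (n′ ∸_) (toℕ-clamp e≤))

  opposite-adjacent : ∀ e → e < n′ →
    suc (toℕ (Fin.opposite (clamp n′ (suc e)))) ≡ toℕ (Fin.opposite (clamp n′ e))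
  opposite-adjacent e e<n′ =
    trans (cong suc (toℕ-opposite-clamp e<n′))
          (trans (sym (+-∸-assoc 1 e<n′)) (sym (toℕ-opposite-clamp (<⇒≤ e<n′))))

-- Shapes: sets of cells (c, e) = (column, distance from the boundary row)

Point : ℕ → ℕ → ℕ → Set
Point x c e = c ≡ x × e ≡ 0

Column : ℕ → ℕ → ℕ → ℕ → Set
Column x d c e = c ≡ x × e ≤ d

RowSegment : ℕ → ℕ → ℕ → ℕ → ℕ → Set
RowSegment d s t c e = s ≤ c × c ≤ t × e ≡ d

U : ℕ → ℕ → ℕ → ℕ → ℕ → Set
U s t d c e = ((c ≡ s ⊎ c ≡ t) × e ≤ d) ⊎ (s ≤ c × c ≤ t × e ≡ d)

-- Row 1 outside the open interval (s, t) is an arc of the cycle through the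
-- seam between the last and the first column.
BackU : ℕ → ℕ → ℕ → ℕ → Set
BackU s t c e = ((c ≡ s ⊎ c ≡ t) × e ≤ 1) ⊎ ((c ≤ s ⊎ t ≤ c) × e ≡ 1)

U-columns : s ≤ t → U s t d c e → s ≤ c × c ≤ t
U-columns s≤t (inj₁ (inj₁ refl , _)) = ≤-refl , s≤t
U-columns s≤t (inj₁ (inj₂ refl , _)) = s≤t , ≤-refl
U-columns s≤t (inj₂ (s≤c , c≤t , _)) = s≤c , c≤t

U-depth : U s t d c e → e ≤ d
U-depth (inj₁ (_ , e≤d))     = e≤d
U-depth (inj₂ (_ , _ , refl)) = ≤-refl

Point-U-disjoint : x ≢ s → x ≢ t → 1 ≤ d → Point x c e → ¬ U s t d c e
Point-U-disjoint x≢s x≢t 1≤d (refl , refl) (inj₁ (inj₁ x≡s , _)) = x≢s x≡s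
Point-U-disjoint x≢s x≢t 1≤d (refl , refl) (inj₁ (inj₂ x≡t , _)) = x≢t x≡t
Point-U-disjoint x≢s x≢t 1≤d (refl , refl) (inj₂ (_ , _ , 0≡d))  = <⇒≢ 1≤d 0≡d

Point-BackU-disjoint : x ≢ s → x ≢ t → Point x c e → ¬ BackU s t c e
Point-BackU-disjoint x≢s x≢t (refl , refl) (inj₁ (inj₁ x≡s , _)) = x≢s x≡s
Point-BackU-disjoint x≢s x≢t (refl , refl) (inj₁ (inj₂ x≡t , _)) = x≢t x≡t
Point-BackU-disjoint x≢s x≢t (refl , refl) (inj₂ (_ , ()))

U-U-disjoint-apart : s ≤ t → s′ ≤ t′ → t < s′ → U s t d c e → ¬ U s′ t′ d′ c e
U-U-disjoint-apart s≤t s′≤t′ t<s′ u u′ =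
  <⇒≱ (<-≤-trans t<s′ (proj₁ (U-columns s′≤t′ u′))) (proj₂ (U-columns s≤t u))

U-U-disjoint-nested : s < s′ → t′ < t → s′ ≤ t′ → d′ < d → U s t d c e → ¬ U s′ t′ d′ c e
U-U-disjoint-nested s<s′ t′<t s′≤t′ d′<d (inj₁ (inj₁ refl , _)) u′ = <⇒≱ s<s′ (proj₁ (U-columns s′≤t′ u′))
U-U-disjoint-nested s<s′ t′<t s′≤t′ d′<d (inj₁ (inj₂ refl , _)) u′ = <⇒≱ t′<t (proj₂ (U-columns s′≤t′ u′))
U-U-disjoint-nested s<s′ t′<t s′≤t′ d′<d (inj₂ (_ , _ , refl))   u′ = <⇒≱ d′<d (U-depth u′)

BackU-U-disjoint-nested : s < s′ → t′ < t → s′ ≤ t′ → BackU s t c e → ¬ U s′ t′ d′ c e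
BackU-U-disjoint-nested s<s′ t′<t s′≤t′ (inj₁ (inj₁ refl , _)) u′ =
  <⇒≱ s<s′ (proj₁ (U-columns s′≤t′ u′))
BackU-U-disjoint-nested s<s′ t′<t s′≤t′ (inj₁ (inj₂ refl , _)) u′ =
  <⇒≱ t′<t (proj₂ (U-columns s′≤t′ u′))
BackU-U-disjoint-nested s<s′ t′<t s′≤t′ (inj₂ (inj₁ c≤s , _)) u′ =
  <⇒≱ s<s′ (≤-trans (proj₁ (U-columns s′≤t′ u′)) c≤s)
BackU-U-disjoint-nested s<s′ t′<t s′≤t′ (inj₂ (inj₂ t≤c , _)) u′ =
  <⇒≱ t′<t (≤-trans t≤c (proj₂ (U-columns s′≤t′ u′)))

module Grid (m′ n′ : ℕ) {b : Fin (suc n′)} (rows : RowOrder n′ b) where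

  open RowOrder rows

  private
    variable
      C D : ℕ → ℕ → Set
      u v : Vertex (suc m′) (suc n′)

  at : ℕ → ℕ → Vertex (suc m′) (suc n′)
  at c e = clamp m′ c , row e

  at-injective : c ≤ m′ → e ≤ n′ → c′ ≤ m′ → e′ ≤ n′ → at c e ≡ at c′ e′ → c ≡ c′ × e ≡ e′
  at-injective c≤ e≤ c′≤ e′≤ eq =
    trans (sym (toℕ-clamp c≤)) (trans (cong (toℕ ∘ proj₁) eq) (toℕ-clamp c′≤)) ,
    row-injective e≤ e′≤ (cong proj₂ eq)

  at-boundary : (i : Fin (suc m′)) → at (toℕ i) 0 ≡ (i , b)
  at-boundary i = cong₂ _,_ (clamp-toℕ m′ i) row-0

  InShape : (ℕ → ℕ → Set) → Vertex (suc m′) (suc n′) → Set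
  InShape C v = ∃₂ λ c e → c ≤ m′ × e ≤ n′ × C c e × v ≡ at c e

  cell : c ≤ m′ → e ≤ n′ → C c e → InShape C (at c e)
  cell c≤ e≤ h = _ , _ , c≤ , e≤ , h , refl

  InShape-disjoint : (∀ {c e} → C c e → ¬ D c e) → InShape C v → ¬ InShape D v
  InShape-disjoint C∩D=∅ (c , e , c≤ , e≤ , h , refl) (c′ , e′ , c′≤ , e′≤ , h′ , eq)
    with refl , refl ← at-injective c≤ e≤ c′≤ e′≤ eq = C∩D=∅ h h′

  reshape : (∀ {c e} → C c e → D c e) → WalkIn (InShape C) u v → WalkIn (InShape D) u v
  reshape C⊆D = mapᵂ λ (c , e , c≤ , e≤ , h , eq) → c , e , c≤ , e≤ , C⊆D h , eq

  private
    down : c ≤ m′ → e < n′ → Adj (suc m′) (suc n′) (at c e) (at c (suc e))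
    down _ e< = inj₂ (refl , row-adjacent e<)

    across : c < m′ → Adj (suc m′) (suc n′) (at c e) (at (suc c) e)
    across c< = inj₁ (refl , inj₁ (trans (cong suc (toℕ-clamp (<⇒≤ c<))) (sym (toℕ-clamp c<))))

    seam : Adj (suc m′) (suc n′) (at 0 e) (at m′ e)
    seam = inj₁ (refl , inj₂ (inj₂ (inj₁ (refl , cong suc (toℕ-clamp ≤-refl)))))

  column : c ≤ m′ → d ≤ n′ → WalkIn (InShape (Column c d)) (at c 0) (at c d)
  column {d = zero}  c≤ _   = [ cell c≤ z≤n (refl , z≤n) ]ᵂ
  column {d = suc d} c≤ d<n′ =
    reshape (λ (c≡ , e≤) → c≡ , m≤n⇒m≤1+n e≤) (column c≤ (<⇒≤ d<n′)) ++ᵂ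
    stepᵂ (down c≤ d<n′) (cell c≤ (<⇒≤ d<n′) (refl , n≤1+n d)) [ cell c≤ d<n′ (refl , ≤-refl) ]ᵂ

  rowSegment : s ≤′ t → t ≤ m′ → d ≤ n′ → WalkIn (InShape (RowSegment d s t)) (at s d) (at t d)
  rowSegment ≤′-refl t≤ d≤ = [ cell t≤ d≤ (≤-refl , ≤-refl , refl) ]ᵂ
  rowSegment {s} {suc t} (≤′-step s≤′t) t<m′ d≤ =
    reshape (λ (s≤c , c≤t , e≡) → s≤c , m≤n⇒m≤1+n c≤t , e≡) (rowSegment s≤′t (<⇒≤ t<m′) d≤) ++ᵂ
    stepᵂ (across t<m′) (cell (<⇒≤ t<m′) d≤ (s≤t , n≤1+n t , refl))
          [ cell t<m′ d≤ (m≤n⇒m≤1+n s≤t , ≤-refl , refl) ]ᵂ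
    where s≤t = ≤′⇒≤ s≤′t

  uRoute : s ≤ t → t ≤ m′ → d ≤ n′ → WalkIn (InShape (U s t d)) (at s 0) (at t 0)
  uRoute s≤t t≤ d≤ =
    reshape (λ (c≡ , e≤) → inj₁ (inj₁ c≡ , e≤)) (column (≤-trans s≤t t≤) d≤) ++ᵂ
    reshape inj₂ (rowSegment (≤⇒≤′ s≤t) t≤ d≤) ++ᵂ
    reverseᵂ (reshape (λ (c≡ , e≤) → inj₁ (inj₂ c≡ , e≤)) (column t≤ d≤))

  backURoute : s ≤ t → t ≤ m′ → 1 ≤ n′ → WalkIn (InShape (BackU s t)) (at s 0) (at t 0)
  backURoute s≤t t≤ 1≤n′ =
    reshape (λ (c≡ , e≤) → inj₁ (inj₁ c≡ , e≤)) (column (≤-trans s≤t t≤) 1≤n′) ++ᵂ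
    reverseᵂ (reshape (λ (_ , c≤s , e≡) → inj₂ (inj₁ c≤s , e≡))
                      (rowSegment (≤⇒≤′ z≤n) (≤-trans s≤t t≤) 1≤n′)) ++ᵂ
    stepᵂ seam (cell z≤n 1≤n′ (inj₂ (inj₁ z≤n , refl)))
      (reverseᵂ (reshape (λ (t≤c , _ , e≡) → inj₂ (inj₂ t≤c , e≡)) (rowSegment (≤⇒≤′ t≤) ≤-refl 1≤n′)) ++ᵂ
       reverseᵂ (reshape (λ (c≡ , e≤) → inj₁ (inj₂ c≡ , e≤)) (column t≤ 1≤n′)))

-- Blocks as intervals of the boundary cycle

module _ {m : ℕ} where

  endpoints : Block m → Fin m × Fin m
  endpoints (single x) = x , x
  endpoints (pair s t _) with toℕ s <? toℕ t
  ... | yes _ = s , t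
  ... | no _  = t , s

  left right : Block m → Fin m
  left  = proj₁ ∘ endpoints
  right = proj₂ ∘ endpoints

  lo hi : Block m → ℕ
  lo = toℕ ∘ left
  hi = toℕ ∘ right

  left∈blockVerts : ∀ B → left B ∈ blockVerts B
  left∈blockVerts (single x) = here refl
  left∈blockVerts (pair s t _) with toℕ s <? toℕ t
  ... | yes _ = here refl
  ... | no _  = there (here refl)

  right∈blockVerts : ∀ B → right B ∈ blockVerts B
  right∈blockVerts (single x) = here refl
  right∈blockVerts (pair s t _) with toℕ s <? toℕ t
  ... | yes _ = there (here refl)
  ... | no _  = here refl

  ends-sorted : ∀ B → (srcB B ≡ left B × tgtB B ≡ right B) ⊎ (srcB B ≡ right B × tgtB B ≡ left B)
  ends-sorted (single x) = inj₁ (refl , refl)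
  ends-sorted (pair s t _) with toℕ s <? toℕ t
  ... | yes _ = inj₁ (refl , refl)
  ... | no _  = inj₂ (refl , refl)

  lo≤hi : ∀ B → lo B ≤ hi B
  lo≤hi (single x) = ≤-refl
  lo≤hi (pair s t _) with toℕ s <? toℕ t
  ... | yes s<t = <⇒≤ s<t
  ... | no s≮t  = ≮⇒≥ s≮t

  lo<hi : ∀ s t (s≢t : s ≢ t) → lo (pair s t s≢t) < hi (pair s t s≢t)
  lo<hi s t s≢t with toℕ s <? toℕ t
  ... | yes s<t = s<t
  ... | no s≮t  = ≤∧≢⇒< (≮⇒≥ s≮t) (s≢t ∘ sym ∘ toℕ-injective)

  toℕ-<⇒≢ : {i j : Fin m} → toℕ i < toℕ j → i ≢ j
  toℕ-<⇒≢ i<j i≡j = <⇒≢ i<j (cong toℕ i≡j)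

  Disjoint⇒toℕ-≢ : ∀ {xs ys : List (Fin m)} → Disjoint xs ys →
                   ∀ {i j} → i ∈ xs → j ∈ ys → toℕ i ≢ toℕ j
  Disjoint⇒toℕ-≢ xs∩ys=∅ i∈ j∈ i≡j with refl ← toℕ-injective i≡j = xs∩ys=∅ (i∈ , j∈)

module Depth {m : ℕ} (Π : Pattern m) where

  -- lo Q < hi Q singles out the pairs among the blocks.
  Encloses : Block m → Block m → Set
  Encloses P Q = lo P ≤ lo Q × hi Q ≤ hi P × lo Q < hi Q

  encloses? : ∀ P → Decidable (Encloses P)
  encloses? P Q = lo P ≤? lo Q ×-dec hi Q ≤? hi P ×-dec lo Q <? hi Q

  depth : Block m → ℕ
  depth P = length (filter (encloses? P) Π)

  depth-pos : ∀ {P} → P ∈ Π → lo P < hi P → 1 ≤ depth P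
  depth-pos {P} P∈Π lo<hi = filter-some (encloses? P) (lose P∈Π (≤-refl , ≤-refl , lo<hi))

  depth<length : ∀ {P Q} → Q ∈ Π → ¬ Encloses P Q → depth P < length Π
  depth<length {P} Q∈Π ¬enc = filter-notAll (encloses? P) Π (lose Q∈Π ¬enc)

  depth-<-enclosing : ∀ {P Q} → P ∈ Π → lo P < hi P → lo P < lo Q → hi Q < hi P → depth Q < depth P
  depth-<-enclosing {P} {Q} P∈Π lo<hi lo< <hi =
    length-filter-< (encloses? Q) (encloses? P) Π
      (λ _ (lo≤ , ≤hi , proper) → ≤-trans (<⇒≤ lo<) lo≤ , ≤-trans ≤hi (<⇒≤ <hi) , proper)
      (lose P∈Π ((≤-refl , ≤-refl , lo<hi) , λ (lo≤ , _) → <⇒≱ lo< lo≤))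

module Laminarity {m : ℕ} {Π : Pattern m} (crossFree : CrossFree Π) where

  private
    variable
      P Q : Block m

  data Laminar (P Q : Block m) : Set where
    left-of  : hi P < lo Q → Laminar P Q
    right-of : hi Q < lo P → Laminar P Q
    around   : lo P < lo Q → hi Q < hi P → Laminar P Q
    within   : lo Q < lo P → hi P < hi Q → Laminar P Q

  Laminar-sym : Laminar P Q → Laminar Q P
  Laminar-sym (left-of hi<lo)  = right-of hi<lo
  Laminar-sym (right-of hi<lo) = left-of hi<lo
  Laminar-sym (around lo< <hi) = within lo< <hi
  Laminar-sym (within lo< <hi) = around lo< <hi

  pairIn : P ∈ Π → lo P < hi P → PairIn (left P) (right P) Π
  pairIn {P} P∈Π lo<hi = P , P∈Π , ends-sorted P , toℕ-<⇒≢ lo<hi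

  crossing-impossible : P ∈ Π → Q ∈ Π → lo P < lo Q → lo Q < hi P → hi P < hi Q → ⊥
  crossing-impossible {P} {Q} P∈Π Q∈Π l₁ l₂ l₃ =
    crossFree (left P) (right P) (left Q) (right Q)
      ( toℕ-<⇒≢ (<-trans l₁ l₂) , toℕ-<⇒≢ l₁ , toℕ-<⇒≢ (<-trans l₁ (<-trans l₂ l₃))
      , toℕ-<⇒≢ l₂ ∘ sym , toℕ-<⇒≢ l₃ , toℕ-<⇒≢ (<-trans l₂ l₃))
      (pairIn P∈Π (<-trans l₁ l₂)) (pairIn Q∈Π (<-trans l₂ l₃))
      (inj₁ (inj₁ (l₁ , l₂ , l₃)))

  private
    laminar-< : P ∈ Π → Q ∈ Π → Disjoint (blockVerts P) (blockVerts Q) → lo P < lo Q → Laminar P Q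
    laminar-< {P} {Q} P∈Π Q∈Π P∩Q=∅ lo< with <-cmp (hi P) (lo Q)
    ... | tri< hi<lo _ _ = left-of hi<lo
    ... | tri≈ _ hi≡lo _ = ⊥-elim (Disjoint⇒toℕ-≢ P∩Q=∅ (right∈blockVerts P) (left∈blockVerts Q) hi≡lo)
    ... | tri> _ _ lo<hi with <-cmp (hi Q) (hi P)
    ...   | tri< <hi _ _ = around lo< <hi
    ...   | tri≈ _ hi≡hi _ = ⊥-elim (Disjoint⇒toℕ-≢ P∩Q=∅ (right∈blockVerts P) (right∈blockVerts Q) (sym hi≡hi))
    ...   | tri> _ _ hi< = ⊥-elim (crossing-impossible P∈Π Q∈Π lo< lo<hi hi<)

  laminar : P ∈ Π → Q ∈ Π → Disjoint (blockVerts P) (blockVerts Q) → Laminar P Q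
  laminar {P} {Q} P∈Π Q∈Π P∩Q=∅ with <-cmp (lo P) (lo Q)
  ... | tri< lo< _ _ = laminar-< P∈Π Q∈Π P∩Q=∅ lo<
  ... | tri≈ _ lo≡lo _ = ⊥-elim (Disjoint⇒toℕ-≢ P∩Q=∅ (left∈blockVerts P) (left∈blockVerts Q) lo≡lo)
  ... | tri> _ _ lo> = Laminar-sym (laminar-< Q∈Π P∈Π (Disjoint.sym P∩Q=∅) lo>)

module Routing (m′ n′ : ℕ) {b : Fin (suc n′)} (rows : RowOrder n′ b)
               (Π : Pattern (suc m′)) (isPattern : IsPattern Π) (crossFree : CrossFree Π)
               (k≤n : length Π ≤ suc n′) (1≤n′ : 1 ≤ n′) where

  open Grid m′ n′ rows
  open Depth Π
  open Laminarity crossFree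

  private
    variable
      P Q : Block (suc m′)
      R : Vertex (suc m′) (suc n′) → Set

  PairShape : Block (suc m′) → ℕ → ℕ → Set
  PairShape P c e =
    (depth P ≤ n′ × U (lo P) (hi P) (depth P) c e) ⊎ (n′ < depth P × BackU (lo P) (hi P) c e)

  Shape : Block (suc m′) → ℕ → ℕ → Set
  Shape (single x)       = Point (toℕ x)
  Shape P@(pair _ _ _) = PairShape P

  deep⇒encloses : ∀ P {Q} → n′ < depth P → Q ∈ Π → Encloses P Q
  deep⇒encloses P {Q} deep Q∈Π with encloses? P Q
  ... | yes enc = enc
  ... | no ¬enc = contradiction (s≤s⁻¹ (<-≤-trans (depth<length {P} Q∈Π ¬enc) k≤n)) (<⇒≱ deep)

  PairShape-disjoint-apart : P ∈ Π → Q ∈ Π → hi P < lo Q → PairShape P c e → ¬ PairShape Q c e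
  PairShape-disjoint-apart {P} {Q} _ _ hi<lo (inj₁ (_ , u)) (inj₁ (_ , u′)) =
    U-U-disjoint-apart (lo≤hi P) (lo≤hi Q) hi<lo u u′
  PairShape-disjoint-apart {P} {Q} _ Q∈Π hi<lo (inj₂ (deep , _)) _ =
    <⇒≱ (<-≤-trans hi<lo (lo≤hi Q)) (proj₁ (proj₂ (deep⇒encloses P deep Q∈Π)))
  PairShape-disjoint-apart {P} {Q} P∈Π _ hi<lo (inj₁ _) (inj₂ (deep , _)) =
    <⇒≱ (≤-<-trans (lo≤hi P) hi<lo) (proj₁ (deep⇒encloses Q deep P∈Π))

  PairShape-disjoint-nested : P ∈ Π → lo P < hi P → Q ∈ Π → lo P < lo Q → hi Q < hi P →
                              PairShape P c e → ¬ PairShape Q c e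
  PairShape-disjoint-nested {Q = Q} P∈Π _ _ lo< _ _ (inj₂ (deep , _)) =
    <⇒≱ lo< (proj₁ (deep⇒encloses Q deep P∈Π))
  PairShape-disjoint-nested {Q = Q} P∈Π lo<hi _ lo< <hi (inj₁ (_ , u)) (inj₁ (_ , u′)) =
    U-U-disjoint-nested lo< <hi (lo≤hi Q) (depth-<-enclosing {Q = Q} P∈Π lo<hi lo< <hi) u u′
  PairShape-disjoint-nested {Q = Q} _ _ _ lo< <hi (inj₂ (_ , u)) (inj₁ (_ , u′)) =
    BackU-U-disjoint-nested lo< <hi (lo≤hi Q) u u′

  Point-PairShape-disjoint : Q ∈ Π → lo Q < hi Q → x ≢ lo Q → x ≢ hi Q →
                             Point x c e → ¬ PairShape Q c e
  Point-PairShape-disjoint Q∈Π lo<hi x≢lo x≢hi pt (inj₁ (_ , u)) =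
    Point-U-disjoint x≢lo x≢hi (depth-pos Q∈Π lo<hi) pt u
  Point-PairShape-disjoint _ _ x≢lo x≢hi pt (inj₂ (_ , u)) =
    Point-BackU-disjoint x≢lo x≢hi pt u

  Shape-disjoint : ∀ P Q → P ∈ Π → Q ∈ Π → Disjoint (blockVerts P) (blockVerts Q) →
                   Shape P c e → ¬ Shape Q c e
  Shape-disjoint (single x) (single y) _ _ P∩Q=∅ (refl , _) (c≡y , _) =
    Disjoint⇒toℕ-≢ P∩Q=∅ (here refl) (here refl) c≡y
  Shape-disjoint (single x) Q@(pair s t s≢t) _ Q∈Π P∩Q=∅ =
    Point-PairShape-disjoint Q∈Π (lo<hi s t s≢t)
      (Disjoint⇒toℕ-≢ P∩Q=∅ (here refl) (left∈blockVerts Q))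
      (Disjoint⇒toℕ-≢ P∩Q=∅ (here refl) (right∈blockVerts Q))
  Shape-disjoint P@(pair s t s≢t) (single x) P∈Π _ P∩Q=∅ shP ptQ =
    Point-PairShape-disjoint P∈Π (lo<hi s t s≢t)
      (Disjoint⇒toℕ-≢ (Disjoint.sym P∩Q=∅) (here refl) (left∈blockVerts P))
      (Disjoint⇒toℕ-≢ (Disjoint.sym P∩Q=∅) (here refl) (right∈blockVerts P)) ptQ shP
  Shape-disjoint P@(pair s t s≢t) Q@(pair s′ t′ s′≢t′) P∈Π Q∈Π P∩Q=∅ shP shQ
    with laminar P∈Π Q∈Π P∩Q=∅
  ... | left-of hi<lo  = PairShape-disjoint-apart P∈Π Q∈Π hi<lo shP shQ
  ... | right-of hi<lo = PairShape-disjoint-apart Q∈Π P∈Π hi<lo shQ shP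
  ... | around lo< <hi = PairShape-disjoint-nested P∈Π (lo<hi s t s≢t) Q∈Π lo< <hi shP shQ
  ... | within lo< <hi = PairShape-disjoint-nested Q∈Π (lo<hi s′ t′ s′≢t′) P∈Π lo< <hi shQ shP

  pairWalk : ∀ P → WalkIn (InShape (PairShape P)) (left P , b) (right P , b)
  pairWalk P = subst₂ (WalkIn _) (at-boundary (left P)) (at-boundary (right P)) route
    where
    route : WalkIn (InShape (PairShape P)) (at (lo P) 0) (at (hi P) 0)
    route with depth P ≤? n′
    ... | yes shallow = reshape (λ u → inj₁ (shallow , u))
                                (uRoute (lo≤hi P) (toℕ≤pred[n] (right P)) shallow)
    ... | no ¬shallow = reshape (λ u → inj₂ (≰⇒> ¬shallow , u))
                                (backURoute (lo≤hi P) (toℕ≤pred[n] (right P)) 1≤n′)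

  orient : ∀ P → WalkIn R (left P , b) (right P , b) → WalkIn R (srcB P , b) (tgtB P , b)
  orient P w with ends-sorted P
  ... | inj₁ (src≡ , tgt≡) = subst₂ (WalkIn _) (cong (_, b) (sym src≡)) (cong (_, b) (sym tgt≡)) w
  ... | inj₂ (src≡ , tgt≡) = subst₂ (WalkIn _) (cong (_, b) (sym src≡)) (cong (_, b) (sym tgt≡)) (reverseᵂ w)

  blockWalk : ∀ P → WalkIn (InShape (Shape P)) (srcB P , b) (tgtB P , b)
  blockWalk (single x) =
    subst₂ (WalkIn _) (at-boundary x) (at-boundary x) [ cell (toℕ≤pred[n] x) z≤n (refl , refl) ]ᵂ
  blockWalk P@(pair _ _ _) = orient P (pairWalk P)

  blockPath : (i : Fin (length Π)) →
              ∃ λ p → IsPath (suc m′) (suc n′) (srcB (lookup Π i) , b) (tgtB (lookup Π i) , b) p ×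
                      All (InShape (Shape (lookup Π i))) p
  blockPath i = pathIn (blockWalk (lookup Π i))

  blockPaths-disjoint : ∀ i j (v : Vertex (suc m′) (suc n′)) →
                        v ∈ proj₁ (blockPath i) → v ∈ proj₁ (blockPath j) → i ≡ j
  blockPaths-disjoint i j v v∈i v∈j with i Fin.≟ j
  ... | yes i≡j = i≡j
  ... | no i≢j  = ⊥-elim (InShape-disjoint
          (Shape-disjoint _ _ (∈-lookup i) (∈-lookup j)
             (Unique-concatMap⇒Disjoint blockVerts Π isPattern i≢j))
          (All.lookup (proj₂ (proj₂ (blockPath i))) v∈i)
          (All.lookup (proj₂ (proj₂ (blockPath j))) v∈j))

  linkage : Linkage (suc m′) (suc n′) b Π
  linkage = record
    { path     = λ i → proj₁ (blockPath i)
    ; isPath   = λ i → proj₁ (proj₂ (blockPath i))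
    ; disjoint = blockPaths-disjoint
    }

lemma4p2 : (m n k : ℕ) → 3 ≤ m → 2 ≤ n → (b : Fin n) → IsBoundaryRow n b →
    (Π : Pattern m) → IsPattern Π → length Π ≡ k →
    CrossFree Π → k ≤ n → Linkage m n b Π
lemma4p2 zero     _        _ () _ _ _ _ _ _ _ _
lemma4p2 (suc m′) zero     _ _ () _ _ _ _ _ _ _
lemma4p2 (suc m′) (suc n′) k _ (s≤s 1≤n′) b boundary Π isPattern refl crossFree k≤n =
  Routing.linkage m′ n′ (rowOrder boundary) Π isPattern crossFree k≤n 1≤n′
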